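{- Let $n\ge 2$. Then $B(Q_n)=n$. Furthermore, a zero blocking set $W$ of $Q_n$ is minimum (i.e. $|W|=n$) if and only if either $W=N(x)$ for some vertex $x$ of $Q_n$, or $n=4$ and $W=N(y)\,\Delta\, N(z)$ for two vertices $y,z$ of $Q_4$ with $|y\,\Delta\, z|=2$.
   Context: The hypercube $Q_n$ is the graph whose vertices are the subsets of $[n]=\{1,\ldots,n\}$, with $x,y$ adjacent iff $|x\,\Delta\, y|=1$, where $A\,\Delta\, B=(A\cup B)\setminus(A\cap B)$. $N(x)$ is the set of neighbors of $x$. In a graph each vertex is black or white; in the zero forcing process, if a black vertex has exactly one white neighbor $w$, then $w$ becomes black, iterated. A set $S$ of initially black vertices is a failed zero forcing set if the process does not make all vertices black, and then its complement (the initial set of white vertices) is a zero blocking set. $B(G)$ is the minimum size of a zero blocking set of $G$. -}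

module Defs where

open import Data.Nat using (ℕ; zero; suc)
open import Data.Bool using (Bool; true; false; not; _xor_)
open import Data.Vec using (Vec; []; _∷_)
open import Data.List using (List; []; _∷_; map; _++_; length; filter)
open import Data.Fin.Subset using (Subset; _∪_; _∩_; _─_; ∣_∣)
open import Data.Product using (Σ; _×_; _,_)
open import Relation.Binary.PropositionalEquality using (_≡_; _≢_)
open import Relation.Nullary using (¬_)
open import Data.Bool using (T)
open import Relation.Nullary.Decidable using (⌊_⌋)
import Data.Bool as B

Vertex : ℕ → Set
Vertex n = Subset n

_Δ_ : ∀ {n} → Subset n → Subset n → Subset n
A Δ B = (A ∪ B) ─ (A ∩ B)

Adj : ∀ {n} → Vertex n → Vertex n → Set
Adj x y = ∣ x Δ y ∣ ≡ 1

VSet : ℕ → Set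
VSet n = Vertex n → Bool

allVertices : (n : ℕ) → List (Vertex n)
allVertices zero = [] ∷ []
allVertices (suc n) = map (true ∷_) (allVertices n) ++ map (false ∷_) (allVertices n)

card : ∀ {n} → VSet n → ℕ
card {n} W = length (filter (λ v → B.T? (W v)) (allVertices n))

compl : ∀ {n} → VSet n → VSet n
compl W v = not (W v)

N : ∀ {n} → Vertex n → VSet n
N x v = ⌊ ∣ x Δ v ∣ Data.Nat.≟ 1 ⌋

_ΔV_ : ∀ {n} → VSet n → VSet n → VSet n
(U ΔV W) v = U v xor W v

_≐_ : ∀ {n} → VSet n → VSet n → Set
U ≐ W = ∀ v → U v ≡ W v

-- Final black set of the zero forcing process started from the black set S:
-- the least set containing S and closed under the forcing rule
-- "if u is black, w is a neighbour of u and every other neighbour of u is black,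
--  then w becomes black". (This equals the outcome of the iterated process.)
data Black {n : ℕ} (S : VSet n) : Vertex n → Set where
  initial : ∀ {v} → T (S v) → Black S v
  force   : ∀ {u w} → Black S u → Adj u w →
            (∀ v → Adj u v → v ≢ w → Black S v) → Black S w

FailedZF : ∀ {n} → VSet n → Set
FailedZF {n} S = ¬ (∀ (v : Vertex n) → Black S v)

ZeroBlocking : ∀ {n} → VSet n → Set
ZeroBlocking W = FailedZF (compl W)

-- A set W blocks zero forcing iff it contains a fort: a nonempty set F such that no vertex outside F
-- has exactly one neighbour in F (the vertices that are never forced form one).  So B(Q_n) is the
-- least size of a fort of Q_n.  Deleting a coordinate i sends a fort F to a fort of Q_{n-1}, the
-- union (shadow) of the two halves of F, and |F| = |shadow| + |common part of the halves|.  By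
-- induction a fort has at least n vertices, and at least n + 1 if it contains an edge.  The same
-- induction identifies the forts attaining these bounds: with an edge, a closed neighbourhood N[x]
-- or two parallel edges of Q₃; without an edge, the shadow is a fort with an edge of least size, which
-- lifts back to N(x), or, from the Q₃ exception, to N(y) Δ N(z) in Q₄.  A minimum blocking set equals
-- the fort it contains.

module Submission where

open import Defs
open import Data.Nat using (ℕ; zero; suc; _+_; _≤_; z≤n; s≤s; _≟_; _≤?_)
open import Data.Nat.Properties
open import Algebra.Properties.CommutativeSemigroup +-commutativeSemigroup using (x∙yz≈y∙xz; interchange)
open import Data.Bool using (Bool; true; false; not; _∧_; _∨_; _xor_; T)
open import Data.Bool.Properties
  using (not-involutive; ¬-not; xor-same; xor-comm; ∨-zeroʳ; ∨-identityʳ; ∨-idem;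
         ∨-conicalˡ; ∨-conicalʳ; ∧-conicalˡ; ∧-conicalʳ)
import Data.Bool as B
open import Data.Vec using (_∷_; []; head; tail; lookup; replicate; updateAt; insertAt; removeAt)
open import Data.Vec.Properties
  using (≡-dec; updateAt-updateAt; updateAt-cong; updateAt-id; updateAt-commutes;
         insertAt-lookup; removeAt-insertAt; insertAt-removeAt)
open import Data.List using (List; []; _∷_; map; _++_; length; filter)
open import Data.List.Properties using (length-++; filter-++)
open import Data.Fin using (Fin; zero; suc)
import Data.Fin as Fin
import Data.Fin.Properties as Fin
open import Data.Fin.Subset using (∣_∣)
open import Data.Product using (Σ; ∃; _×_; _,_; proj₁; proj₂)
open import Data.Sum using (_⊎_; inj₁; inj₂; swap)
open import Data.Empty using (⊥)
open import Relation.Nullary using (¬_; Dec; yes; no; ¬?; contradiction; ¬¬-map)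
open import Relation.Nullary.Decidable
  using (⌊_⌋; decidable-stable; from-yes; _×-dec_; _⊎-dec_; _→-dec_; ¬¬-excluded-middle)
open import Data.Fin.Subset.Properties using (anySubset?)
open import Relation.Binary.PropositionalEquality
open import Function.Base using (_∘_)
open import Function.Bundles using (_⇔_; mk⇔)

variable
  n : ℕ

bit : Bool → ℕ
bit true  = 1
bit false = 0

not-≢ : ∀ b → not b ≢ b
not-≢ true  ()
not-≢ false ()

xor-not : ∀ a → a xor not a ≡ true
xor-not true  = refl
xor-not false = refl

bool-ext : (a b : Bool) → (a ≡ true → b ≡ true) → (b ≡ true → a ≡ true) → a ≡ b
bool-ext true  true  _ _ = refl
bool-ext false false _ _ = refl
bool-ext true  false f _ = sym (f refl)
bool-ext false true  _ g = g refl

module _ {A : Set} where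

  ⌊⌋≡true⇒ : (a? : Dec A) → ⌊ a? ⌋ ≡ true → A
  ⌊⌋≡true⇒ (yes a) _ = a

  ⇒⌊⌋≡true : (a? : Dec A) → A → ⌊ a? ⌋ ≡ true
  ⇒⌊⌋≡true (yes _) _ = refl
  ⇒⌊⌋≡true (no ¬a) a = contradiction a ¬a

  ⇒⌊⌋≡false : (a? : Dec A) → ¬ A → ⌊ a? ⌋ ≡ false
  ⇒⌊⌋≡false (yes a) ¬a = contradiction a ¬a
  ⇒⌊⌋≡false (no _)  _  = refl

allBool? : {P : Bool → Set} → Dec (P true) → Dec (P false) → Dec (∀ b → P b)
allBool? (yes pt) (yes pf) = yes λ { true → pt ; false → pf }
allBool? (no ¬pt) _        = no λ p → ¬pt (p true)
allBool? _        (no ¬pf) = no λ p → ¬pf (p false)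

-- Hypercube geometry

dist : Vertex n → Vertex n → ℕ
dist x y = ∣ x Δ y ∣

dist-∷ : ∀ a b (x y : Vertex n) → dist (a ∷ x) (b ∷ y) ≡ bit (a xor b) + dist x y
dist-∷ true  true  x y = refl
dist-∷ true  false x y = refl
dist-∷ false true  x y = refl
dist-∷ false false x y = refl

dist-self : (x : Vertex n) → dist x x ≡ 0
dist-self []      = refl
dist-self (a ∷ x) rewrite dist-∷ a a x x | xor-same a = dist-self x

dist-sym : (x y : Vertex n) → dist x y ≡ dist y x
dist-sym []      []      = refl
dist-sym (a ∷ x) (b ∷ y) rewrite dist-∷ a b x y | dist-∷ b a y x | xor-comm a b | dist-sym x y = refl

dist≡0⇒≡ : (x y : Vertex n) → dist x y ≡ 0 → x ≡ y
dist≡0⇒≡ []           []           _ = refl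
dist≡0⇒≡ (true ∷ x)  (true ∷ y)  e = cong (true ∷_) (dist≡0⇒≡ x y e)
dist≡0⇒≡ (false ∷ x) (false ∷ y) e = cong (false ∷_) (dist≡0⇒≡ x y e)

Adj-sym : (x y : Vertex n) → Adj x y → Adj y x
Adj-sym x y = trans (dist-sym y x)

Adj-irrefl : (x : Vertex n) → ¬ Adj x x
Adj-irrefl x a = contradiction (trans (sym (dist-self x)) a) λ ()

toggle : Fin n → Vertex n → Vertex n
toggle i x = updateAt x i not

Adj-toggle : (i : Fin n) (x : Vertex n) → Adj x (toggle i x)
Adj-toggle zero    (b ∷ x) rewrite dist-∷ b (not b) x x | xor-not b | dist-self x = refl
Adj-toggle (suc i) (b ∷ x) rewrite dist-∷ b b x (toggle i x) | xor-same b = Adj-toggle i x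

Adj⇒toggle : (x y : Vertex n) → Adj x y → ∃ λ i → y ≡ toggle i x
Adj⇒toggle []          []          ()
Adj⇒toggle (true ∷ x)  (true ∷ y)  e = let i , p = Adj⇒toggle x y e in suc i , cong (true ∷_) p
Adj⇒toggle (false ∷ x) (false ∷ y) e = let i , p = Adj⇒toggle x y e in suc i , cong (false ∷_) p
Adj⇒toggle (true ∷ x)  (false ∷ y) e = zero , cong (false ∷_) (sym (dist≡0⇒≡ x y (suc-injective e)))
Adj⇒toggle (false ∷ x) (true ∷ y)  e = zero , cong (true ∷_) (sym (dist≡0⇒≡ x y (suc-injective e)))

toggle-involutive : (i : Fin n) (x : Vertex n) → toggle i (toggle i x) ≡ x
toggle-involutive i x =
  trans (updateAt-updateAt i x) (trans (updateAt-cong i not-involutive x) (updateAt-id i x))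

toggle-comm : (i j : Fin n) (x : Vertex n) → toggle i (toggle j x) ≡ toggle j (toggle i x)
toggle-comm i j x with i Fin.≟ j
... | yes refl = refl
... | no i≢j   = updateAt-commutes i j i≢j x

toggle-injective : (i j : Fin n) (x : Vertex n) → toggle i x ≡ toggle j x → i ≡ j
toggle-injective zero    zero    x       e = refl
toggle-injective zero    (suc j) (b ∷ x) e = contradiction (cong head e) (not-≢ b)
toggle-injective (suc i) zero    (b ∷ x) e = contradiction (sym (cong head e)) (not-≢ b)
toggle-injective (suc i) (suc j) (b ∷ x) e = cong suc (toggle-injective i j x (cong tail e))

toggle-≢ : (i : Fin n) (x : Vertex n) → toggle i x ≢ x
toggle-≢ i x eq = Adj-irrefl x (subst (Adj x) eq (Adj-toggle i x))

another : (a : Fin (suc (suc n))) → ∃ λ c → a ≢ c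
another zero    = suc zero , λ ()
another (suc a) = zero , λ ()

Q₂-nbrs : (y v : Vertex 2) → Adj y v → v ≡ toggle zero y ⊎ v ≡ toggle (suc zero) y
Q₂-nbrs y v adj with Adj⇒toggle y v adj
... | zero      , refl = inj₁ refl
... | suc zero  , refl = inj₂ refl

dist-toggle² : (a c : Fin n) (x : Vertex n) → a ≢ c → dist x (toggle a (toggle c x)) ≡ 2
dist-toggle² zero    zero    x       ne = contradiction refl ne
dist-toggle² zero    (suc c) (b ∷ x) ne
  rewrite dist-∷ b (not b) x (toggle c x) | xor-not b | Adj-toggle c x = refl
dist-toggle² (suc a) zero    (b ∷ x) ne
  rewrite dist-∷ b (not b) x (toggle a x) | xor-not b | Adj-toggle a x = refl
dist-toggle² (suc a) (suc c) (b ∷ x) ne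
  rewrite dist-∷ b b x (toggle a (toggle c x)) | xor-same b = dist-toggle² a c x (ne ∘ cong suc)

dist-toggle³ : (e a c : Fin n) (x : Vertex n) → e ≢ a → e ≢ c → a ≢ c →
               dist x (toggle e (toggle a (toggle c x))) ≡ 3
dist-toggle³ zero    zero    c       x       n₁ n₂ n₃ = contradiction refl n₁
dist-toggle³ zero    (suc a) zero    x       n₁ n₂ n₃ = contradiction refl n₂
dist-toggle³ (suc e) zero    zero    x       n₁ n₂ n₃ = contradiction refl n₃
dist-toggle³ zero    (suc a) (suc c) (b ∷ x) n₁ n₂ n₃
  rewrite dist-∷ b (not b) x (toggle a (toggle c x)) | xor-not b | dist-toggle² a c x (n₃ ∘ cong suc) = refl
dist-toggle³ (suc e) zero    (suc c) (b ∷ x) n₁ n₂ n₃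
  rewrite dist-∷ b (not b) x (toggle e (toggle c x)) | xor-not b | dist-toggle² e c x (n₂ ∘ cong suc) = refl
dist-toggle³ (suc e) (suc a) zero    (b ∷ x) n₁ n₂ n₃
  rewrite dist-∷ b (not b) x (toggle e (toggle a x)) | xor-not b | dist-toggle² e a x (n₁ ∘ cong suc) = refl
dist-toggle³ (suc e) (suc a) (suc c) (b ∷ x) n₁ n₂ n₃
  rewrite dist-∷ b b x (toggle e (toggle a (toggle c x))) | xor-same b =
  dist-toggle³ e a c x (n₁ ∘ cong suc) (n₂ ∘ cong suc) (n₃ ∘ cong suc)

common-nbrs-toggle² : (a c : Fin n) (x v : Vertex n) → a ≢ c →
  Adj (toggle a (toggle c x)) v → v ≡ x ⊎ Adj x v → v ≡ toggle c x ⊎ v ≡ toggle a x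
common-nbrs-toggle² a c x v a≢c z~v v-near with Adj⇒toggle (toggle a (toggle c x)) v z~v
... | e , refl with e Fin.≟ a | e Fin.≟ c
... | yes refl | _        = inj₁ (toggle-involutive e (toggle c x))
... | no _     | yes refl = inj₂ (trans (cong (toggle e) (toggle-comm a e x)) (toggle-involutive e (toggle a x)))
... | no e≢a   | no e≢c   with v-near | dist-toggle³ e a c x e≢a e≢c a≢c
...   | inj₁ eq  | d = contradiction (trans (sym d) (trans (cong (dist x) eq) (dist-self x))) λ ()
...   | inj₂ adj | d = contradiction (trans (sym d) adj) λ ()

toggle²-≢ : (a c : Fin n) (x : Vertex n) → a ≢ c → toggle a (toggle c x) ≢ x
toggle²-≢ a c x a≢c eq =
  contradiction (trans (sym (dist-toggle² a c x a≢c)) (trans (cong (dist x) eq) (dist-self x))) λ ()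

toggle²-not-Adj : (a c : Fin n) (x : Vertex n) → a ≢ c → ¬ Adj x (toggle a (toggle c x))
toggle²-not-Adj a c x a≢c adj = contradiction (trans (sym (dist-toggle² a c x a≢c)) adj) λ ()

insertAt-injective : (i : Fin (suc n)) {a b : Bool} {u v : Vertex n} →
                     insertAt u i a ≡ insertAt v i b → a ≡ b × u ≡ v
insertAt-injective i {a} {b} {u} {v} e =
  trans (sym (insertAt-lookup u i a)) (trans (cong (λ z → lookup z i) e) (insertAt-lookup v i b)) ,
  trans (sym (removeAt-insertAt u i a)) (trans (cong (λ z → removeAt z i) e) (removeAt-insertAt v i b))

insertAt-surjective : (i : Fin (suc n)) (w : Vertex (suc n)) → ∃ λ c → ∃ λ v → w ≡ insertAt v i c
insertAt-surjective i w = lookup w i , removeAt w i , sym (insertAt-removeAt w i)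

dist-insertAt : (i : Fin (suc n)) (a b : Bool) (u v : Vertex n) →
                dist (insertAt u i a) (insertAt v i b) ≡ bit (a xor b) + dist u v
dist-insertAt zero    a b u       v       = dist-∷ a b u v
dist-insertAt (suc i) a b (c ∷ u) (d ∷ v) = begin
  dist (c ∷ insertAt u i a) (d ∷ insertAt v i b)   ≡⟨ dist-∷ c d (insertAt u i a) (insertAt v i b) ⟩
  bit (c xor d) + dist (insertAt u i a) (insertAt v i b)
                                                   ≡⟨ cong (bit (c xor d) +_) (dist-insertAt i a b u v) ⟩
  bit (c xor d) + (bit (a xor b) + dist u v)       ≡⟨ x∙yz≈y∙xz (bit (c xor d)) (bit (a xor b)) (dist u v) ⟩
  bit (a xor b) + (bit (c xor d) + dist u v)       ≡⟨ cong (bit (a xor b) +_) (sym (dist-∷ c d u v)) ⟩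
  bit (a xor b) + dist (c ∷ u) (d ∷ v)             ∎
  where open ≡-Reasoning

Adj-insertAt⁻ : (i : Fin (suc n)) (a b : Bool) (u v : Vertex n) → Adj (insertAt u i a) (insertAt v i b) →
                (b ≡ not a × v ≡ u) ⊎ (b ≡ a × Adj u v)
Adj-insertAt⁻ i a b u v adj with trans (sym (dist-insertAt i a b u v)) adj
Adj-insertAt⁻ i true  true  u v adj | d = inj₂ (refl , d)
Adj-insertAt⁻ i false false u v adj | d = inj₂ (refl , d)
Adj-insertAt⁻ i true  false u v adj | d = inj₁ (refl , sym (dist≡0⇒≡ u v (suc-injective d)))
Adj-insertAt⁻ i false true  u v adj | d = inj₁ (refl , sym (dist≡0⇒≡ u v (suc-injective d)))

Adj-insertAt-across : (i : Fin (suc n)) (a : Bool) (u : Vertex n) → Adj (insertAt u i a) (insertAt u i (not a))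
Adj-insertAt-across i a u rewrite dist-insertAt i a (not a) u u | xor-not a | dist-self u = refl

Adj-insertAt-within : (i : Fin (suc n)) (a : Bool) (u v : Vertex n) →
                      Adj u v → Adj (insertAt u i a) (insertAt v i a)
Adj-insertAt-within i a u v adj rewrite dist-insertAt i a a u v | xor-same a = adj

Adj-insertAt-view : (i : Fin (suc n)) (b : Bool) (u : Vertex n) (w : Vertex (suc n)) →
  Adj (insertAt u i b) w → w ≡ insertAt u i (not b) ⊎ ∃ λ v → Adj u v × w ≡ insertAt v i b
Adj-insertAt-view i b u w adj with insertAt-surjective i w
... | c , v , refl with Adj-insertAt⁻ i b c u v adj
...   | inj₁ (refl , refl) = inj₁ refl
...   | inj₂ (refl , u~v)  = inj₂ (v , u~v , refl)

toggle-insertAt : (i : Fin (suc n)) (c : Bool) (w : Vertex n) → toggle i (insertAt w i c) ≡ insertAt w i (not c)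
toggle-insertAt zero    c w       = refl
toggle-insertAt (suc i) c (d ∷ w) = cong (d ∷_) (toggle-insertAt i c w)

_≟ᵛ_ : (x y : Vertex n) → Dec (x ≡ y)
_≟ᵛ_ = ≡-dec B._≟_

_⊆ᵛ_ : VSet n → VSet n → Set
U ⊆ᵛ W = ∀ v → U v ≡ true → W v ≡ true

_∪ᵛ_ : VSet n → VSet n → VSet n
(U ∪ᵛ W) v = U v ∨ W v

_∩ᵛ_ : VSet n → VSet n → VSet n
(U ∩ᵛ W) v = U v ∧ W v

single : Vertex n → VSet n
single x v = ⌊ v ≟ᵛ x ⌋

N[_] : Vertex n → VSet n
N[ x ] v = single x v ∨ N x v

N⇒Adj : (x v : Vertex n) → N x v ≡ true → Adj x v
N⇒Adj x v = ⌊⌋≡true⇒ (dist x v ≟ 1)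

Adj⇒N : (x v : Vertex n) → Adj x v → N x v ≡ true
Adj⇒N x v = ⇒⌊⌋≡true (dist x v ≟ 1)

N-self : (x : Vertex n) → N x x ≡ false
N-self x = ⇒⌊⌋≡false (dist x x ≟ 1) (Adj-irrefl x)

single⇒≡ : (x v : Vertex n) → single x v ≡ true → v ≡ x
single⇒≡ x v = ⌊⌋≡true⇒ (v ≟ᵛ x)

single-self : (x : Vertex n) → single x x ≡ true
single-self x = ⇒⌊⌋≡true (x ≟ᵛ x) refl

N[]-self : (x : Vertex n) → N[ x ] x ≡ true
N[]-self x rewrite single-self x = refl

Adj⇒N[] : (x v : Vertex n) → Adj x v → N[ x ] v ≡ true
Adj⇒N[] x v adj rewrite Adj⇒N x v adj = ∨-zeroʳ (single x v)

N[]⇒ : (x v : Vertex n) → N[ x ] v ≡ true → v ≡ x ⊎ Adj x v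
N[]⇒ x v e with single x v in s
... | true  = inj₁ (single⇒≡ x v s)
... | false = inj₂ (N⇒Adj x v e)

N[]-toggle² : (a c : Fin n) (x : Vertex n) → a ≢ c → N[ x ] (toggle a (toggle c x)) ≡ false
N[]-toggle² a c x a≢c with N[ x ] (toggle a (toggle c x)) in e
... | false = refl
... | true with N[]⇒ x _ e
...   | inj₁ eq  = contradiction eq (toggle²-≢ a c x a≢c)
...   | inj₂ adj = contradiction adj (toggle²-not-Adj a c x a≢c)

N[]-Q₁ : (x v : Vertex 1) → N[ x ] v ≡ true
N[]-Q₁ (true ∷ [])  (true ∷ [])  = refl
N[]-Q₁ (true ∷ [])  (false ∷ []) = refl
N[]-Q₁ (false ∷ []) (true ∷ [])  = refl
N[]-Q₁ (false ∷ []) (false ∷ []) = refl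

module _ (i : Fin (suc n)) (b : Bool) (x v : Vertex n) where

  N-insertAt-within : N (insertAt x i b) (insertAt v i b) ≡ N x v
  N-insertAt-within = bool-ext _ _ to from
    where
    to : N (insertAt x i b) (insertAt v i b) ≡ true → N x v ≡ true
    to e with Adj-insertAt⁻ i b b x v (N⇒Adj (insertAt x i b) (insertAt v i b) e)
    ... | inj₁ (b≡¬b , _) = contradiction (sym b≡¬b) (not-≢ b)
    ... | inj₂ (_ , adj)  = Adj⇒N x v adj
    from : N x v ≡ true → N (insertAt x i b) (insertAt v i b) ≡ true
    from e = Adj⇒N (insertAt x i b) (insertAt v i b) (Adj-insertAt-within i b x v (N⇒Adj x v e))

  N-insertAt-across : N (insertAt x i b) (insertAt v i (not b)) ≡ single x v
  N-insertAt-across = bool-ext _ _ to from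
    where
    to : N (insertAt x i b) (insertAt v i (not b)) ≡ true → single x v ≡ true
    to e with Adj-insertAt⁻ i b (not b) x v (N⇒Adj (insertAt x i b) (insertAt v i (not b)) e)
    ... | inj₁ (_ , v≡x)  = ⇒⌊⌋≡true (v ≟ᵛ x) v≡x
    ... | inj₂ (¬b≡b , _) = contradiction ¬b≡b (not-≢ b)
    from : single x v ≡ true → N (insertAt x i b) (insertAt v i (not b)) ≡ true
    from e rewrite single⇒≡ x v e = Adj⇒N (insertAt x i b) (insertAt x i (not b)) (Adj-insertAt-across i b x)

  single-insertAt-within : single (insertAt x i b) (insertAt v i b) ≡ single x v
  single-insertAt-within = bool-ext _ _
    (λ e → ⇒⌊⌋≡true (v ≟ᵛ x)
             (proj₂ (insertAt-injective i (single⇒≡ (insertAt x i b) (insertAt v i b) e))))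
    (λ e → ⇒⌊⌋≡true (insertAt v i b ≟ᵛ insertAt x i b)
             (cong (λ z → insertAt z i b) (single⇒≡ x v e)))

  single-insertAt-across : single (insertAt x i b) (insertAt v i (not b)) ≡ false
  single-insertAt-across = ⇒⌊⌋≡false (insertAt v i (not b) ≟ᵛ insertAt x i b)
    (λ e → not-≢ b (proj₁ (insertAt-injective i e)))

  N[]-insertAt-within : N[ insertAt x i b ] (insertAt v i b) ≡ N[ x ] v
  N[]-insertAt-within = cong₂ _∨_ single-insertAt-within N-insertAt-within

  N[]-insertAt-across : N[ insertAt x i b ] (insertAt v i (not b)) ≡ single x v
  N[]-insertAt-across = cong₂ _∨_ single-insertAt-across N-insertAt-across

all? : {P : Vertex n → Set} → (∀ v → Dec (P v)) → Dec (∀ v → P v)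
all? P? with anySubset? (λ v → ¬? (P? v))
... | yes (v , ¬p) = no λ p → ¬p (p v)
... | no ¬∃¬p      = yes λ v → decidable-stable (P? v) λ ¬p → ¬∃¬p (v , ¬p)

_≐?_ : (U W : VSet n) → Dec (U ≐ W)
U ≐? W = all? λ v → U v B.≟ W v

≐-or-differ : (U W : VSet n) → U ≐ W ⊎ ∃ λ v → U v ≢ W v
≐-or-differ U W with anySubset? (λ v → ¬? (U v B.≟ W v))
... | yes differ = inj₂ differ
... | no ¬differ = inj₁ λ v → decidable-stable (U v B.≟ W v) λ ne → ¬differ (v , ne)

slice : Fin (suc n) → VSet (suc n) → Bool → VSet n
slice i G b v = G (insertAt v i b)

slices⇒≐ : (i : Fin (suc n)) (G H : VSet (suc n)) (b : Bool) →
           slice i G b ≐ slice i H b → slice i G (not b) ≐ slice i H (not b) → G ≐ H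
slices⇒≐ i G H b same other w with insertAt-surjective i w
slices⇒≐ i G H true  same other w | true  , v , refl = same v
slices⇒≐ i G H true  same other w | false , v , refl = other v
slices⇒≐ i G H false same other w | true  , v , refl = other v
slices⇒≐ i G H false same other w | false , v , refl = same v

-- Counting

count : VSet n → ℕ
count {zero}  W = bit (W [])
count {suc n} W = count (slice zero W true) + count (slice zero W false)

length-filter-map : {A C : Set} (P : C → Bool) (f : A → C) (l : List A) →
  length (filter (λ v → B.T? (P v)) (map f l)) ≡ length (filter (λ v → B.T? (P (f v))) l)
length-filter-map P f []      = refl
length-filter-map P f (x ∷ l) with P (f x)
... | true  = cong suc (length-filter-map P f l)
... | false = length-filter-map P f l

card≡count : (W : VSet n) → card W ≡ count W
card≡count {zero}  W with W []
... | true  = refl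
... | false = refl
card≡count {suc n} W = begin
  length (filter P (map (true ∷_) vs ++ map (false ∷_) vs))
    ≡⟨ cong length (filter-++ P (map (true ∷_) vs) (map (false ∷_) vs)) ⟩
  length (filter P (map (true ∷_) vs) ++ filter P (map (false ∷_) vs))
    ≡⟨ length-++ (filter P (map (true ∷_) vs)) ⟩
  length (filter P (map (true ∷_) vs)) + length (filter P (map (false ∷_) vs))
    ≡⟨ cong₂ _+_ (trans (length-filter-map W (true ∷_) vs) (card≡count (slice zero W true)))
                 (trans (length-filter-map W (false ∷_) vs) (card≡count (slice zero W false))) ⟩
  count W ∎
  where
  open ≡-Reasoning
  P = λ v → B.T? (W v)
  vs = allVertices n

count-cong : (U W : VSet n) → U ≐ W → count U ≡ count W
count-cong {zero}  U W e = cong bit (e [])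
count-cong {suc n} U W e =
  cong₂ _+_ (count-cong _ _ (λ v → e (true ∷ v))) (count-cong _ _ (λ v → e (false ∷ v)))

count-empty : (W : VSet n) → (∀ v → W v ≡ false) → count W ≡ 0
count-empty {zero}  W h rewrite h [] = refl
count-empty {suc n} W h
  rewrite count-empty (slice zero W true) (λ v → h (true ∷ v))
        | count-empty (slice zero W false) (λ v → h (false ∷ v)) = refl

bit-mono : (a b : Bool) → (a ≡ true → b ≡ true) → bit a ≤ bit b
bit-mono true  true  h = ≤-refl
bit-mono true  false h = contradiction (h refl) λ ()
bit-mono false b     h = z≤n

count-mono : (U W : VSet n) → U ⊆ᵛ W → count U ≤ count W
count-mono {zero}  U W h = bit-mono (U []) (W []) (h [])
count-mono {suc n} U W h =
  +-mono-≤ (count-mono _ _ (λ v → h (true ∷ v))) (count-mono _ _ (λ v → h (false ∷ v)))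

count-strict : (U W : VSet n) → U ⊆ᵛ W → ∀ v → W v ≡ true → U v ≡ false → suc (count U) ≤ count W
count-strict {zero}  U W h [] w u rewrite w | u = ≤-refl
count-strict {suc n} U W h (true ∷ v) w u =
  +-mono-≤ (count-strict _ _ (λ v → h (true ∷ v)) v w u) (count-mono _ _ (λ v → h (false ∷ v)))
count-strict {suc n} U W h (false ∷ v) w u = ≤-trans (≤-reflexive (sym (+-suc _ _)))
  (+-mono-≤ (count-mono _ _ (λ v → h (true ∷ v))) (count-strict _ _ (λ v → h (false ∷ v)) v w u))

count-≥1 : (W : VSet n) (v : Vertex n) → W v ≡ true → 1 ≤ count W
count-≥1 W v w =
  subst (_≤ count W) (cong suc (count-empty ∅ (λ _ → refl))) (count-strict ∅ W (λ _ ()) v w refl)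
  where ∅ = λ _ → false

count-≥2 : (W : VSet n) (u v : Vertex n) → W u ≡ true → W v ≡ true → u ≢ v → 2 ≤ count W
count-≥2 W u v wu wv u≢v = ≤-trans (s≤s (count-≥1 (single v) v (single-self v)))
  (count-strict (single v) W sv⊆W u wu (⇒⌊⌋≡false (u ≟ᵛ v) u≢v))
  where
  sv⊆W : single v ⊆ᵛ W
  sv⊆W x e rewrite single⇒≡ v x e = wv

⊆∧count≤⇒≐ : (U W : VSet n) → U ⊆ᵛ W → count W ≤ count U → W ≐ U
⊆∧count≤⇒≐ U W U⊆W ≤U v with W v in w | U v in u
... | true  | true  = refl
... | false | false = refl
... | false | true  = contradiction (trans (sym w) (U⊆W v u)) λ ()
... | true  | false = contradiction (≤-trans (count-strict U W U⊆W v w u) ≤U) (<-irrefl refl)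

count≤1⇒unique : (W : VSet n) → count W ≤ 1 → ∀ u v → W u ≡ true → W v ≡ true → u ≡ v
count≤1⇒unique W ≤1 u v wu wv with u ≟ᵛ v
... | yes u≡v = u≡v
... | no  u≢v = contradiction (≤-trans (count-≥2 W u v wu wv u≢v) ≤1) λ { (s≤s ()) }

bit-∨+∧ : (a b : Bool) → bit (a ∨ b) + bit (a ∧ b) ≡ bit a + bit b
bit-∨+∧ true  true  = refl
bit-∨+∧ true  false = refl
bit-∨+∧ false true  = refl
bit-∨+∧ false false = refl

count-∪+∩ : (U W : VSet n) → count (U ∪ᵛ W) + count (U ∩ᵛ W) ≡ count U + count W
count-∪+∩ {zero}  U W = bit-∨+∧ (U []) (W [])
count-∪+∩ {suc n} U W = begin
  (count (U₁ ∪ᵛ W₁) + count (U₀ ∪ᵛ W₀)) + (count (U₁ ∩ᵛ W₁) + count (U₀ ∩ᵛ W₀))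
    ≡⟨ interchange (count (U₁ ∪ᵛ W₁)) _ _ _ ⟩
  (count (U₁ ∪ᵛ W₁) + count (U₁ ∩ᵛ W₁)) + (count (U₀ ∪ᵛ W₀) + count (U₀ ∩ᵛ W₀))
    ≡⟨ cong₂ _+_ (count-∪+∩ U₁ W₁) (count-∪+∩ U₀ W₀) ⟩
  (count U₁ + count W₁) + (count U₀ + count W₀)
    ≡⟨ interchange (count U₁) _ _ _ ⟩
  (count U₁ + count U₀) + (count W₁ + count W₀) ∎
  where
  open ≡-Reasoning
  U₁ = slice zero U true
  U₀ = slice zero U false
  W₁ = slice zero W true
  W₀ = slice zero W false

count-slices : (i : Fin (suc n)) (W : VSet (suc n)) → count W ≡ count (slice i W true) + count (slice i W false)
count-slices zero    W = refl
count-slices {suc n} (suc i) W = begin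
  count (slice zero W true) + count (slice zero W false)
    ≡⟨ cong₂ _+_ (count-slices i (slice zero W true)) (count-slices i (slice zero W false)) ⟩
  (count (λ v → W (true ∷ insertAt v i true)) + count (λ v → W (true ∷ insertAt v i false))) +
  (count (λ v → W (false ∷ insertAt v i true)) + count (λ v → W (false ∷ insertAt v i false)))
    ≡⟨ interchange (count (λ v → W (true ∷ insertAt v i true))) _ _ _ ⟩
  count (slice (suc i) W true) + count (slice (suc i) W false) ∎
  where open ≡-Reasoning

count-single : (x : Vertex n) → count (single x) ≡ 1
count-single [] = refl
count-single (true ∷ x) = cong₂ _+_
  (trans (count-cong _ _ (single-insertAt-within zero true x)) (count-single x))
  (count-empty _ (single-insertAt-across zero true x))
count-single (false ∷ x) = cong₂ _+_
  (count-empty _ (single-insertAt-across zero false x))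
  (trans (count-cong _ _ (single-insertAt-within zero false x)) (count-single x))

count-N : (x : Vertex n) → count (N x) ≡ n
count-N [] = refl
count-N {suc n} (true ∷ x) = begin
  count (slice zero (N (true ∷ x)) true) + count (slice zero (N (true ∷ x)) false)
    ≡⟨ cong₂ _+_ (count-cong _ _ (N-insertAt-within zero true x))
                 (count-cong _ _ (N-insertAt-across zero true x)) ⟩
  count (N x) + count (single x)
    ≡⟨ cong₂ _+_ (count-N x) (count-single x) ⟩
  n + 1
    ≡⟨ +-comm n 1 ⟩
  suc n ∎
  where open ≡-Reasoning
count-N (false ∷ x) = cong₂ _+_
  (trans (count-cong _ _ (N-insertAt-across zero false x)) (count-single x))
  (trans (count-cong _ _ (N-insertAt-within zero false x)) (count-N x))

-- Forts

FortRule : VSet n → Set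
FortRule {n} F = ∀ u w → F u ≡ false → Adj u w → F w ≡ true →
                 ∃ λ w′ → Adj u w′ × w′ ≢ w × F w′ ≡ true

record Fort (F : VSet n) : Set where
  constructor fort
  field
    nonempty : ∃ λ v → F v ≡ true
    rule     : FortRule F

HasEdge : VSet n → Set
HasEdge {n} G = ∃ λ u → ∃ λ v → G u ≡ true × G v ≡ true × Adj u v

Fort-cong : (F G : VSet n) → F ≐ G → Fort F → Fort G
Fort-cong F G F≐G (fort (v , fv) rule) = fort (v , trans (sym (F≐G v)) fv) rule′
  where
  rule′ : FortRule G
  rule′ u w gu adj gw =
    let w′ , adj′ , w′≢w , fw′ = rule u w (trans (F≐G u) gu) adj (trans (F≐G w) gw)
    in  w′ , adj′ , w′≢w , trans (sym (F≐G w′)) fw′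

FortRule-twins : (F : VSet n) → FortRule F → ∀ x p q → F x ≡ false → Adj x p → Adj x q →
                 (∀ v → Adj x v → F v ≡ true → v ≡ p ⊎ v ≡ q) → F p ≡ F q
FortRule-twins F rule x p q fx x~p x~q only =
  bool-ext _ _ (twin p q x~p only) (twin q p x~q (λ v a f → swap (only v a f)))
  where
  twin : ∀ p q → Adj x p → (∀ v → Adj x v → F v ≡ true → v ≡ p ⊎ v ≡ q) →
         F p ≡ true → F q ≡ true
  twin p q x~p only fp with rule x p fx x~p fp
  ... | w , x~w , w≢p , fw with only w x~w fw
  ...   | inj₁ w≡p  = contradiction w≡p w≢p
  ...   | inj₂ refl = fw

Fort-≥2 : (F : VSet (suc n)) → Fort F → 2 ≤ count F
Fort-≥2 F (fort (v , fv) rule) with F (toggle zero v) in fu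
... | true  = count-≥2 F v (toggle zero v) fv fu (≢-sym (toggle-≢ zero v))
... | false = let w , _ , w≢v , fw = rule (toggle zero v) v fu (Adj-sym v _ (Adj-toggle zero v)) fv
              in  count-≥2 F w v fw fv w≢v

Q₁-Fort-full : (G : VSet 1) → Fort G → ∀ v → G v ≡ true
Q₁-Fort-full G f v = sym (⊆∧count≤⇒≐ G (λ _ → true) (λ _ _ → refl) (Fort-≥2 G f) v)

-- Deleting a coordinate

module _ (i : Fin (suc n)) (G : VSet (suc n)) where

  shadow : VSet n
  shadow = slice i G true ∪ᵛ slice i G false

  common : VSet n
  common = slice i G true ∩ᵛ slice i G false

  slice⊆shadow : ∀ b → slice i G b ⊆ᵛ shadow
  slice⊆shadow true  v e = cong (_∨ slice i G false v) e
  slice⊆shadow false v e = trans (cong (slice i G true v ∨_) e) (∨-zeroʳ _)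

  ∉shadow⇒∉slice : ∀ b v → shadow v ≡ false → slice i G b v ≡ false
  ∉shadow⇒∉slice true  v e = ∨-conicalˡ _ _ e
  ∉shadow⇒∉slice false v e = ∨-conicalʳ _ _ e

  shadow⇒slice : ∀ v → shadow v ≡ true → ∃ λ b → slice i G b v ≡ true
  shadow⇒slice v e with slice i G true v in t
  ... | true  = true , t
  ... | false = false , e

  shadow∖slice⇒slice : ∀ b v → shadow v ≡ true → slice i G b v ≡ false → slice i G (not b) v ≡ true
  shadow∖slice⇒slice true  v s ∉b rewrite ∉b = s
  shadow∖slice⇒slice false v s ∉b rewrite ∉b = trans (sym (∨-identityʳ _)) s

  common-intro : ∀ b v → slice i G b v ≡ true → slice i G (not b) v ≡ true → common v ≡ true
  common-intro true  v p q rewrite p | q = refl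
  common-intro false v p q rewrite p | q = refl

  common⇒slice : ∀ b v → common v ≡ true → slice i G b v ≡ true
  common⇒slice true  v e = ∧-conicalˡ _ _ e
  common⇒slice false v e = ∧-conicalʳ _ _ e

  count-shadow+common : count shadow + count common ≡ count G
  count-shadow+common = trans (count-∪+∩ (slice i G true) (slice i G false)) (sym (count-slices i G))

  count-shadow+common-≥ : ∀ {a b} → a ≤ count shadow → b ≤ count common → a + b ≤ count G
  count-shadow+common-≥ a≤ b≤ = ≤-trans (+-mono-≤ a≤ b≤) (≤-reflexive count-shadow+common)

  slices-≐⇒shadow≐ : slice i G true ≐ slice i G false → shadow ≐ slice i G true
  slices-≐⇒shadow≐ eq v = trans (cong (slice i G true v ∨_) (sym (eq v))) (∨-idem _)

  slices-≐⇒count : slice i G true ≐ slice i G false → count G ≡ count (slice i G true) + count (slice i G true)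
  slices-≐⇒count eq = trans (count-slices i G) (cong (count (slice i G true) +_) (sym (count-cong _ _ eq)))

module _ (i : Fin (suc n)) (G : VSet (suc n)) where

  shadow-Fort : Fort G → Fort (shadow i G)
  shadow-Fort (fort (v , gv) rule) = fort nonempty rule′
    where
    nonempty : ∃ λ u → shadow i G u ≡ true
    nonempty with insertAt-surjective i v
    ... | c , u , refl = u , slice⊆shadow i G c u gv
    rule′ : FortRule (shadow i G)
    rule′ u w u∉ u~w w∈ with shadow⇒slice i G w w∈
    ... | b , sw with rule (insertAt u i b) (insertAt w i b) (∉shadow⇒∉slice i G b u u∉)
                           (Adj-insertAt-within i b u w u~w) sw
    ... | w′ , u~w′ , w′≢w , gw′ with Adj-insertAt-view i b u w′ u~w′
    ...   | inj₁ refl = contradiction (trans (sym (∉shadow⇒∉slice i G (not b) u u∉)) gw′) λ ()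
    ...   | inj₂ (v , u~v , refl) = v , u~v , (λ v≡w → w′≢w (cong (λ z → insertAt z i b) v≡w)) ,
                                    slice⊆shadow i G b v gw′

  slice-nbr : FortRule G → ∀ b v → slice i G b v ≡ false → slice i G (not b) v ≡ true →
              ∃ λ v′ → Adj v v′ × slice i G b v′ ≡ true
  slice-nbr rule b v ∉b ∈¬b
    with rule (insertAt v i b) (insertAt v i (not b)) ∉b (Adj-insertAt-across i b v) ∈¬b
  ... | w′ , v~w′ , w′≢ , gw′ with Adj-insertAt-view i b v w′ v~w′
  ...   | inj₁ refl = contradiction refl w′≢
  ...   | inj₂ (v′ , v~v′ , refl) = v′ , v~v′ , gw′

  one-slice⇒HasEdge : FortRule G → ∀ b v → slice i G b v ≡ false → slice i G (not b) v ≡ true →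
                      HasEdge (shadow i G)
  one-slice⇒HasEdge rule b v ∉b ∈¬b =
    let v′ , v~v′ , ∈b = slice-nbr rule b v ∉b ∈¬b
    in  v , v′ , slice⊆shadow i G (not b) v ∈¬b , slice⊆shadow i G b v′ ∈b , v~v′

  slices-differ⇒HasEdge : FortRule G → ∀ v → slice i G true v ≢ slice i G false v → HasEdge (shadow i G)
  slices-differ⇒HasEdge rule v differ with slice i G true v in t | slice i G false v in f
  ... | true  | true  = contradiction refl differ
  ... | false | false = contradiction refl differ
  ... | true  | false = one-slice⇒HasEdge rule false v f t
  ... | false | true  = one-slice⇒HasEdge rule true v t f

  common-empty⇒HasEdge : Fort G → (∀ v → common i G v ≡ false) → HasEdge (shadow i G)
  common-empty⇒HasEdge (fort (w , gw) rule) ∅ with insertAt-surjective i w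
  ... | c , v , refl =
    slices-differ⇒HasEdge rule v λ eq → contradiction (trans (sym (∅ v)) (both c gw eq)) λ ()
    where
    both : ∀ c → slice i G c v ≡ true → slice i G true v ≡ slice i G false v → common i G v ≡ true
    both true  s eq = common-intro i G true  v s (trans (sym eq) s)
    both false s eq = common-intro i G false v s (trans eq s)

  slice-twins : FortRule G → ∀ b z p q → shadow i G z ≡ false → Adj z p → Adj z q →
                (∀ v → Adj z v → slice i G b v ≡ true → v ≡ p ⊎ v ≡ q) → slice i G b p ≡ slice i G b q
  slice-twins rule b z p q z∉ z~p z~q only =
    FortRule-twins G rule (insertAt z i b) (insertAt p i b) (insertAt q i b) (∉shadow⇒∉slice i G b z z∉)
      (Adj-insertAt-within i b z p z~p) (Adj-insertAt-within i b z q z~q) only′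
    where
    only′ : ∀ w → Adj (insertAt z i b) w → G w ≡ true → w ≡ insertAt p i b ⊎ w ≡ insertAt q i b
    only′ w z~w gw with Adj-insertAt-view i b z w z~w
    ... | inj₁ refl = contradiction (trans (sym (∉shadow⇒∉slice i G (not b) z z∉)) gw) λ ()
    ... | inj₂ (v , z~v , refl) with only v z~v gw
    ...   | inj₁ refl = inj₁ refl
    ...   | inj₂ refl = inj₂ refl

slices-≐⇒Fort : (i : Fin (suc n)) (G : VSet (suc n)) → Fort G →
                slice i G true ≐ slice i G false → Fort (slice i G true)
slices-≐⇒Fort i G f same = Fort-cong _ _ (slices-≐⇒shadow≐ i G same) (shadow-Fort i G f)

shadow≐⇒slice⊆ : (i : Fin (suc n)) (G : VSet (suc n)) (H : VSet n) →
                 shadow i G ≐ H → ∀ b → slice i G b ⊆ᵛ H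
shadow≐⇒slice⊆ i G H shadow≐ b v s = trans (sym (shadow≐ v)) (slice⊆shadow i G b v s)

HasEdge⇒common : (G : VSet (suc n)) → HasEdge G → ∃ λ i → ∃ λ w → common i G w ≡ true
HasEdge⇒common G (u , v , gu , gv , u~v) with Adj⇒toggle u v u~v
... | i , refl with insertAt-surjective i u
... | c , w , refl = i , w , common-intro i G c w gu (subst (λ z → G z ≡ true) (toggle-insertAt i c w) gv)

Fort-size      : (G : VSet n) → Fort G → n ≤ count G
Fort-edge-size : (G : VSet n) → Fort G → HasEdge G → suc n ≤ count G
Fort-size-doubled : (A : VSet n) → Fort A → suc (suc n) ≤ count A + count A

Fort-size {zero}  G f = z≤n
Fort-size {suc m} G f with anySubset? (λ v → common zero G v B.≟ true)
... | yes (v , cv) = subst (_≤ count G) (+-comm m 1)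
  (count-shadow+common-≥ zero G (Fort-size _ (shadow-Fort zero G f)) (count-≥1 _ v cv))
... | no ∄common    = subst (_≤ count G) (+-identityʳ (suc m))
  (count-shadow+common-≥ zero G (Fort-edge-size _ (shadow-Fort zero G f) shadow-edge) z≤n)
  where
  shadow-edge = common-empty⇒HasEdge zero G f (λ v → ¬-not λ cv → ∄common (v , cv))

Fort-edge-size {zero}  G f ([] , [] , _ , _ , ())
Fort-edge-size {suc m} G f e with HasEdge⇒common G e
... | i , w , cw with ≐-or-differ (slice i G true) (slice i G false)
...   | inj₁ eq = subst (suc (suc m) ≤_) (sym (slices-≐⇒count i G eq))
  (Fort-size-doubled _ (slices-≐⇒Fort i G f eq))
...   | inj₂ (v , differ) = subst (_≤ count G) (+-comm (suc m) 1)
  (count-shadow+common-≥ i G (Fort-edge-size _ (shadow-Fort i G f) shadow-edge) (count-≥1 _ w cw))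
  where
  shadow-edge = slices-differ⇒HasEdge i G (Fort.rule f) v differ

Fort-size-doubled {zero}  A f = let v , av = Fort.nonempty f ; a≥1 = count-≥1 A v av in +-mono-≤ a≥1 a≥1
Fort-size-doubled {suc m} A f = subst (_≤ count A + count A) (+-comm (suc m) 2)
  (+-mono-≤ (Fort-size A f) (Fort-≥2 A f))

-- Forts attaining the lower bounds

-- In Q₃: the two parallel edges N(y) × Q₁, N(y) being an antipodal pair of Q₂.
ParallelEdges : ∀ n → VSet n → Set
ParallelEdges 3 G = ∃ λ κ → ∃ λ (y : Vertex 2) → ∀ c → slice κ G c ≐ N y
ParallelEdges _ G = ⊥

TightEdgeShape : ∀ n → VSet n → Set
TightEdgeShape n G = (∃ λ x → G ≐ N[ x ]) ⊎ ParallelEdges n G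

TightShape : ∀ n → VSet n → Set
TightShape n W = (Σ (Vertex n) λ x → W ≐ N x)
               ⊎ (n ≡ 4 × Σ (Vertex n) λ y → Σ (Vertex n) λ z → ∣ y Δ z ∣ ≡ 2 × W ≐ (N y ΔV N z))

module _ (i : Fin (suc n)) (G : VSet (suc n)) (rule : FortRule G) (x : Vertex n)
         (shadow≐ : shadow i G ≐ N[ x ]) where

  shadow-N[]-toggle-twins : ∀ b a c → a ≢ c → slice i G b (toggle c x) ≡ slice i G b (toggle a x)
  shadow-N[]-toggle-twins b a c a≢c = slice-twins i G rule b z (toggle c x) (toggle a x) z∉shadow
    (Adj-sym _ z (Adj-toggle a (toggle c x)))
    (Adj-sym _ z (subst (Adj (toggle a x)) (toggle-comm c a x) (Adj-toggle c (toggle a x))))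
    (λ v z~v s → common-nbrs-toggle² a c x v a≢c z~v
                   (N[]⇒ x v (shadow≐⇒slice⊆ i G N[ x ] shadow≐ b v s)))
    where
    z = toggle a (toggle c x)
    z∉shadow = trans (shadow≐ z) (N[]-toggle² a c x a≢c)

module _ (i : Fin (suc (suc n))) (G : VSet (suc (suc n))) (rule : FortRule G)
         (x : Vertex (suc n)) (shadow≐ : shadow i G ≐ N[ x ]) where

  shadow-N[]⇒N[] : common i G x ≡ true → (∀ v → common i G v ≡ true → v ≡ x) → ∃ λ X → G ≐ N[ X ]
  shadow-N[]⇒N[] x∈common common⊆x = insertAt x i b , slices⇒≐ i G N[ insertAt x i b ] b slice-b slice-¬b
    where
    y∈shadow = trans (shadow≐ (toggle zero x)) (Adj⇒N[] x _ (Adj-toggle zero x))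
    b   = proj₁ (shadow⇒slice i G (toggle zero x) y∈shadow)
    y∈b = proj₂ (shadow⇒slice i G (toggle zero x) y∈shadow)
    N[x]⊆b : N[ x ] ⊆ᵛ slice i G b
    N[x]⊆b v n with N[]⇒ x v n
    ... | inj₁ refl = common⇒slice i G b x x∈common
    ... | inj₂ adj with Adj⇒toggle x v adj
    ...   | zero  , refl = y∈b
    ...   | suc a , refl = trans (sym (shadow-N[]-toggle-twins i G rule x shadow≐ b (suc a) zero λ ())) y∈b
    slice-b : slice i G b ≐ slice i N[ insertAt x i b ] b
    slice-b v = trans (bool-ext _ _ (shadow≐⇒slice⊆ i G N[ x ] shadow≐ b v) (N[x]⊆b v))
                      (sym (N[]-insertAt-within i b x v))
    slice-¬b : slice i G (not b) ≐ slice i N[ insertAt x i b ] (not b)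
    slice-¬b v = trans (bool-ext _ _
      (λ s → ⇒⌊⌋≡true (v ≟ᵛ x) (common⊆x v (common-intro i G b v
               (N[x]⊆b v (shadow≐⇒slice⊆ i G N[ x ] shadow≐ (not b) v s)) s)))
      (λ e → subst (λ u → slice i G (not b) u ≡ true) (sym (single⇒≡ x v e))
                   (common⇒slice i G (not b) x x∈common)))
      (sym (N[]-insertAt-across i b x v))

shadow-N[]-common-centre : (i : Fin (suc (suc (suc n)))) (G : VSet (suc (suc (suc n)))) → FortRule G →
  (x : Vertex (suc (suc n))) → shadow i G ≐ N[ x ] →
  ∀ w → common i G w ≡ true → (∀ v → common i G v ≡ true → v ≡ w) → w ≡ x
shadow-N[]-common-centre i G rule x shadow≐ w w∈common common⊆w
  with N[]⇒ x w (shadow≐⇒slice⊆ i G N[ x ] shadow≐ true w (common⇒slice i G true w w∈common))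
... | inj₁ w≡x = w≡x
... | inj₂ adj with Adj⇒toggle x w adj
... | a , refl = contradiction twins q∉¬b
  where
  c   = proj₁ (another a)
  a≢c = proj₂ (another a)
  q = toggle c x
  q∈shadow = trans (shadow≐ q) (Adj⇒N[] x q (Adj-toggle c x))
  b   = proj₁ (shadow⇒slice i G q q∈shadow)
  q∈b = proj₂ (shadow⇒slice i G q q∈shadow)
  twins : slice i G (not b) q ≡ true
  twins = trans (shadow-N[]-toggle-twins i G rule x shadow≐ (not b) a c a≢c)
                (common⇒slice i G (not b) w w∈common)
  q∉¬b : slice i G (not b) q ≢ true
  q∉¬b q∈¬b = a≢c (sym (toggle-injective c a x (common⊆w q (common-intro i G b q q∈b q∈¬b))))

shadow-N[]∧common-single⇒N[] : (i : Fin (suc (suc n))) (G : VSet (suc (suc n))) → FortRule G →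
  (x : Vertex (suc n)) → shadow i G ≐ N[ x ] →
  ∀ w → common i G w ≡ true → (∀ v → common i G v ≡ true → v ≡ w) → ∃ λ X → G ≐ N[ X ]
shadow-N[]∧common-single⇒N[] {zero} i G rule x shadow≐ w w∈common common⊆w =
  shadow-N[]⇒N[] i G rule w (λ v → trans (shadow≐ v) (trans (N[]-Q₁ x v) (sym (N[]-Q₁ w v))))
                 w∈common common⊆w
shadow-N[]∧common-single⇒N[] {suc n} i G rule x shadow≐ w w∈common common⊆w
  with shadow-N[]-common-centre i G rule x shadow≐ w w∈common common⊆w
... | refl = shadow-N[]⇒N[] i G rule x shadow≐ w∈common common⊆w

module _ (i : Fin 4) (G : VSet 4) (rule : FortRule G) (κ : Fin 3) (y : Vertex 2)
         (shadow≐ : ∀ c → slice κ (shadow i G) c ≐ N y) where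

  private
    p q : Bool → Vertex 3
    p c = insertAt (toggle zero y) κ c
    q c = insertAt (toggle (suc zero) y) κ c

    p≢q : ∀ c → p c ≢ q c
    p≢q c e with toggle-injective zero (suc zero) y (proj₂ (insertAt-injective κ e))
    ... | ()

  ParallelEdges-twins : ∀ b c → slice i G b (p c) ≡ slice i G b (q c)
  ParallelEdges-twins b c = slice-twins i G rule b (insertAt y κ c) (p c) (q c) (y∉shadow c)
    (Adj-insertAt-within κ c y _ (Adj-toggle zero y)) (Adj-insertAt-within κ c y _ (Adj-toggle (suc zero) y)) only
    where
    y∉shadow : ∀ c → shadow i G (insertAt y κ c) ≡ false
    y∉shadow c = trans (shadow≐ c y) (N-self y)
    only : ∀ v → Adj (insertAt y κ c) v → slice i G b v ≡ true → v ≡ p c ⊎ v ≡ q c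
    only v y~v s with Adj-insertAt-view κ c y v y~v
    ... | inj₁ refl = contradiction (trans (sym (y∉shadow (not c))) (slice⊆shadow i G b _ s)) λ ()
    ... | inj₂ (u , y~u , refl) with Q₂-nbrs y u y~u
    ...   | inj₁ refl = inj₁ refl
    ...   | inj₂ refl = inj₂ refl

  ParallelEdges-common-twins : ∀ c → common i G (p c) ≡ common i G (q c)
  ParallelEdges-common-twins c = cong₂ _∧_ (ParallelEdges-twins true c) (ParallelEdges-twins false c)

  ParallelEdges-common-not-single : ∀ w → common i G w ≡ true → ¬ (∀ v → common i G v ≡ true → v ≡ w)
  ParallelEdges-common-not-single w w∈common common⊆w with insertAt-surjective κ w
  ... | c , v , refl with Q₂-nbrs y v (N⇒Adj y v w∈N)
    where w∈N = trans (sym (shadow≐ c v)) (slice⊆shadow i G true _ (common⇒slice i G true _ w∈common))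
  ... | inj₁ refl = p≢q c (sym (common⊆w (q c) (trans (sym (ParallelEdges-common-twins c)) w∈common)))
  ... | inj₂ refl = p≢q c (common⊆w (p c) (trans (ParallelEdges-common-twins c) w∈common))

shadow-ParallelEdges-common-not-single : ∀ n (i : Fin (suc (suc n))) (G : VSet (suc (suc n))) → FortRule G →
  ParallelEdges (suc n) (shadow i G) →
  ∀ w → common i G w ≡ true → ¬ (∀ v → common i G v ≡ true → v ≡ w)
shadow-ParallelEdges-common-not-single 2 i G rule (κ , y , shadow≐) =
  ParallelEdges-common-not-single i G rule κ y shadow≐

module _ (i : Fin (suc n)) (F : VSet (suc n)) (edgeless : ¬ HasEdge F) where

  edgeless⇒common-empty : ∀ v → common i F v ≡ false
  edgeless⇒common-empty v = ¬-not λ v∈common → edgeless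
    (insertAt v i true , insertAt v i false ,
     common⇒slice i F true v v∈common , common⇒slice i F false v v∈common , Adj-insertAt-across i true v)

  edgeless⇒one-slice : ∀ b v → slice i F b v ≡ true → slice i F (not b) v ≡ false
  edgeless⇒one-slice b v v∈b = ¬-not λ v∈¬b →
    contradiction (trans (sym (edgeless⇒common-empty v)) (common-intro i F b v v∈b v∈¬b)) λ ()

  edgeless⇒slice-independent : ∀ b u v → slice i F b u ≡ true → slice i F b v ≡ true → ¬ Adj u v
  edgeless⇒slice-independent b u v u∈b v∈b u~v =
    edgeless (insertAt u i b , insertAt v i b , u∈b , v∈b , Adj-insertAt-within i b u v u~v)

  shadow-N[]⇒N : (x : Vertex n) → shadow i F ≐ N[ x ] → ∃ λ X → F ≐ N X
  shadow-N[]⇒N x shadow≐ = insertAt x i (not b) , slices⇒≐ i F (N (insertAt x i (not b))) b slice-b slice-¬b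
    where
    x∈shadow = trans (shadow≐ x) (N[]-self x)
    b   = proj₁ (shadow⇒slice i F x x∈shadow)
    x∈b = proj₂ (shadow⇒slice i F x x∈shadow)
    slice⊆ = shadow≐⇒slice⊆ i F N[ x ] shadow≐
    slice-b : slice i F b ≐ slice i (N (insertAt x i (not b))) b
    slice-b v = trans (bool-ext _ _ to from) (sym across)
      where
      to : slice i F b v ≡ true → single x v ≡ true
      to v∈b with N[]⇒ x v (slice⊆ b v v∈b)
      ... | inj₁ v≡x = ⇒⌊⌋≡true (v ≟ᵛ x) v≡x
      ... | inj₂ x~v = contradiction x~v (edgeless⇒slice-independent b x v x∈b v∈b)
      from : single x v ≡ true → slice i F b v ≡ true
      from e rewrite single⇒≡ x v e = x∈b
      across : N (insertAt x i (not b)) (insertAt v i b) ≡ single x v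
      across = subst (λ c → N (insertAt x i (not b)) (insertAt v i c) ≡ single x v)
                     (not-involutive b) (N-insertAt-across i (not b) x v)
    slice-¬b : slice i F (not b) ≐ slice i (N (insertAt x i (not b))) (not b)
    slice-¬b v = trans (bool-ext _ _ to from) (sym (N-insertAt-within i (not b) x v))
      where
      to : slice i F (not b) v ≡ true → N x v ≡ true
      to v∈¬b with N[]⇒ x v (slice⊆ (not b) v v∈¬b)
      ... | inj₁ refl = contradiction (trans (sym (edgeless⇒one-slice b v x∈b)) v∈¬b) λ ()
      ... | inj₂ x~v = Adj⇒N x v x~v
      from : N x v ≡ true → slice i F (not b) v ≡ true
      from n with shadow⇒slice i F v (trans (shadow≐ v) (Adj⇒N[] x v (N⇒Adj x v n)))
      ... | c , v∈c with b B.≟ c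
      ...   | yes refl = contradiction (N⇒Adj x v n) (edgeless⇒slice-independent b x v x∈b v∈c)
      ...   | no b≢c   = subst (λ c → slice i F c v ≡ true) (¬-not (≢-sym b≢c)) v∈c

-- An edgeless lift to Q₄ of the two parallel edges N(y) × Q₁ of Q₃.
twistedPrism : Bool → Fin 3 → Vertex 2 → VSet 4
twistedPrism b κ y (e ∷ v) = N y (removeAt v κ) ∧ (e xor b xor lookup v κ)

prismCentre : Bool → Fin 3 → Vertex 2 → Bool → Vertex 4
prismCentre b κ y c = (b xor not c) ∷ insertAt y κ c

TwistedPrism-ΔN : Bool → Fin 3 → Vertex 2 → Set
TwistedPrism-ΔN b κ y = let Y = prismCentre b κ y true ; Z = prismCentre b κ y false in
  ∣ Y Δ Z ∣ ≡ 2 × twistedPrism b κ y ≐ (N Y ΔV N Z)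

twistedPrism-ΔN? : ∀ b κ y → Dec (TwistedPrism-ΔN b κ y)
twistedPrism-ΔN? b κ y = let Y = prismCentre b κ y true ; Z = prismCentre b κ y false in
  (∣ Y Δ Z ∣ ≟ 2) ×-dec (twistedPrism b κ y ≐? (N Y ΔV N Z))

twistedPrism-ΔN : ∀ b κ y → TwistedPrism-ΔN b κ y
twistedPrism-ΔN =
  from-yes (allBool? {P = λ b → ∀ κ y → TwistedPrism-ΔN b κ y} (all-κy? true) (all-κy? false))
  where all-κy? = λ b → Fin.all? λ κ → all? (twistedPrism-ΔN? b κ)

ΔN-size : (y z : Vertex 4) → ∣ y Δ z ∣ ≡ 2 → count (N y ΔV N z) ≡ 4
ΔN-size = from-yes (all? λ (y : Vertex 4) → all? λ z → (∣ y Δ z ∣ ≟ 2) →-dec (count (N y ΔV N z) ≟ 4))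

xor-table : ∀ b (f : Bool → Bool → Bool) → f b true ≡ true → f (not b) true ≡ false →
            f b false ≡ false → f (not b) false ≡ true → ∀ e d → f e d ≡ e xor b xor d
xor-table true  f tt ft tf ff true  true  = tt
xor-table true  f tt ft tf ff true  false = tf
xor-table true  f tt ft tf ff false true  = ft
xor-table true  f tt ft tf ff false false = ff
xor-table false f tt ft tf ff true  true  = ft
xor-table false f tt ft tf ff true  false = ff
xor-table false f tt ft tf ff false true  = tt
xor-table false f tt ft tf ff false false = tf

module _ (F : VSet 4) (rule : FortRule F) (edgeless : ¬ HasEdge F) (κ : Fin 3) (y : Vertex 2)
         (shadow≐ : ∀ c → slice κ (shadow zero F) c ≐ N y) where

  shadow-ParallelEdges⇒twistedPrism : ∃ λ b → F ≐ twistedPrism b κ y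
  shadow-ParallelEdges⇒twistedPrism = b , F≐
    where
    p : Bool → Vertex 3
    p d = insertAt (toggle zero y) κ d
    p∈shadow : ∀ d → shadow zero F (p d) ≡ true
    p∈shadow d = trans (shadow≐ d (toggle zero y)) (Adj⇒N y _ (Adj-toggle zero y))
    b    = proj₁ (shadow⇒slice zero F (p true) (p∈shadow true))
    p₁∈b = proj₂ (shadow⇒slice zero F (p true) (p∈shadow true))
    p₀∉b : F (b ∷ p false) ≡ false
    p₀∉b = ¬-not λ p₀∈b → edgeless⇒slice-independent zero F edgeless b (p true) (p false) p₁∈b p₀∈b
             (Adj-insertAt-across κ true (toggle zero y))
    on-p : ∀ e d → F (e ∷ p d) ≡ e xor b xor d
    on-p = xor-table b (λ e d → F (e ∷ p d)) p₁∈b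
      (edgeless⇒one-slice zero F edgeless b (p true) p₁∈b) p₀∉b
      (shadow∖slice⇒slice zero F b (p false) (p∈shadow false) p₀∉b)
    on-slice : ∀ e d u → F (e ∷ insertAt u κ d) ≡ N y u ∧ (e xor b xor d)
    on-slice e d u with N y u in u∈N
    ... | false = ∉shadow⇒∉slice zero F e (insertAt u κ d) (trans (shadow≐ d u) u∈N)
    ... | true with Q₂-nbrs y u (N⇒Adj y u u∈N)
    ...   | inj₁ refl = on-p e d
    ...   | inj₂ refl = trans (sym (ParallelEdges-twins zero F rule κ y shadow≐ e d)) (on-p e d)
    F≐ : F ≐ twistedPrism b κ y
    F≐ (e ∷ v) with insertAt-surjective κ v
    ... | d , u , refl rewrite removeAt-insertAt u κ d | insertAt-lookup u κ d = on-slice e d u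

shadow-ParallelEdges⇒TightShape : ∀ n (F : VSet (suc (suc n))) → FortRule F → ¬ HasEdge F →
  ParallelEdges (suc n) (shadow zero F) → TightShape (suc (suc n)) F
shadow-ParallelEdges⇒TightShape 2 F rule edgeless (κ , y , shadow≐) =
  let b , F≐ = shadow-ParallelEdges⇒twistedPrism F rule edgeless κ y shadow≐
      d , twisted≐ = twistedPrism-ΔN b κ y
  in  inj₂ (refl , prismCentre b κ y true , prismCentre b κ y false , d , λ v → trans (F≐ v) (twisted≐ v))

tight-sum : ∀ {a b n} → n ≤ a → 1 ≤ b → a + b ≡ suc n → a ≡ n × b ≤ 1
tight-sum {a} {b} {n} n≤a 1≤b a+b≡ =
  ≤-antisym (≤-pred (≤-trans (≤-reflexive (+-comm 1 a)) (≤-trans (+-monoʳ-≤ a 1≤b) (≤-reflexive a+b≡))))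
            n≤a ,
  +-cancelˡ-≤ n b 1 (≤-trans (+-monoˡ-≤ b n≤a) (≤-reflexive (trans a+b≡ (+-comm 1 n))))

Fort-doubled-count : (A : VSet (suc n)) → Fort A → count A + count A ≡ suc (suc (suc n)) → n ≡ 1 × count A ≡ 2
Fort-doubled-count {zero} A f c =
  contradiction (≤-trans (+-mono-≤ (Fort-≥2 A f) (Fort-≥2 A f)) (≤-reflexive c)) λ { (s≤s (s≤s (s≤s ()))) }
Fort-doubled-count {suc zero} A f c =
  refl , ≤-antisym (+-cancelˡ-≤ 2 _ 2 (≤-trans (+-monoˡ-≤ (count A) (Fort-≥2 A f)) (≤-reflexive c)))
                   (Fort-≥2 A f)
Fort-doubled-count {suc (suc n)} A f c =
  contradiction (m+n≤o⇒n≤o n (≤-pred (≤-pred (≤-pred (≤-trans (+-mono-≤ (Fort-size A f) (Fort-size A f))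
                                                              (≤-reflexive c))))))
                1+n≰n

TightEdgeForts-classified : ℕ → Set
TightEdgeForts-classified n =
  (G : VSet (suc n)) → Fort G → HasEdge G → count G ≡ suc (suc n) → TightEdgeShape (suc n) G

TightForts-classified : ℕ → Set
TightForts-classified n =
  (F : VSet (suc (suc n))) → Fort F → count F ≡ suc (suc n) → TightShape (suc (suc n)) F

TightEdgeForts-classified-Q₁ : TightEdgeForts-classified 0
TightEdgeForts-classified-Q₁ G f _ _ = inj₁ (true ∷ [] , λ v → trans (Q₁-Fort-full G f v) (sym (N[]-Q₁ _ v)))

TightForts-classified-step : TightEdgeForts-classified n → TightForts-classified n
TightForts-classified-step {n} classify F f cF = lift (classify (shadow zero F) fS shadow-edge cS)
  where
  edgeless : ¬ HasEdge F
  edgeless e = 1+n≰n (≤-trans (Fort-edge-size F f e) (≤-reflexive cF))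
  ∅ = edgeless⇒common-empty zero F edgeless
  fS = shadow-Fort zero F f
  shadow-edge = common-empty⇒HasEdge zero F f ∅
  cS : count (shadow zero F) ≡ suc (suc n)
  cS = trans (sym (+-identityʳ _))
       (trans (cong (count (shadow zero F) +_) (sym (count-empty _ ∅))) (trans (count-shadow+common zero F) cF))
  lift : TightEdgeShape (suc n) (shadow zero F) → TightShape (suc (suc n)) F
  lift (inj₁ (x , shadow≐)) = inj₁ (shadow-N[]⇒N zero F edgeless x shadow≐)
  lift (inj₂ parallel)      = shadow-ParallelEdges⇒TightShape n F (Fort.rule f) edgeless parallel

TightForts-classified-Q₂ : TightForts-classified 0
TightForts-classified-Q₂ = TightForts-classified-step TightEdgeForts-classified-Q₁

doubled-Q₂-fort-shape : (i : Fin 3) (G : VSet 3) → slice i G true ≐ slice i G false →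
  TightShape 2 (slice i G true) → ParallelEdges 3 G
doubled-Q₂-fort-shape i G same (inj₁ (y , A≐)) =
  i , y , λ { true → A≐ ; false v → trans (sym (same v)) (A≐ v) }
doubled-Q₂-fort-shape i G same (inj₂ (() , _))

equal-slices-ParallelEdges : (i : Fin (suc (suc n))) (G : VSet (suc (suc n))) → Fort G →
  count G ≡ suc (suc (suc n)) → slice i G true ≐ slice i G false → ParallelEdges (suc (suc n)) G
equal-slices-ParallelEdges i G f cG same
  with Fort-doubled-count (slice i G true) (slices-≐⇒Fort i G f same)
                          (trans (sym (slices-≐⇒count i G same)) cG)
... | refl , cA≡2 =
  doubled-Q₂-fort-shape i G same (TightForts-classified-Q₂ (slice i G true) (slices-≐⇒Fort i G f same) cA≡2)

distinct-slices-shape : TightEdgeForts-classified n → (i : Fin (suc (suc n))) (G : VSet (suc (suc n))) → Fort G →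
  count G ≡ suc (suc (suc n)) → ∀ w → common i G w ≡ true → ∀ v → slice i G true v ≢ slice i G false v →
  TightEdgeShape (suc (suc n)) G
distinct-slices-shape {n} classify i G f cG w w∈common v differ = lift (classify (shadow i G) fS shadow-edge cS)
  where
  fS = shadow-Fort i G f
  shadow-edge = slices-differ⇒HasEdge i G (Fort.rule f) v differ
  tight = tight-sum (Fort-edge-size _ fS shadow-edge) (count-≥1 (common i G) w w∈common)
                    (trans (count-shadow+common i G) cG)
  cS = proj₁ tight
  common⊆w : ∀ u → common i G u ≡ true → u ≡ w
  common⊆w u u∈common = count≤1⇒unique (common i G) (proj₂ tight) u w u∈common w∈common
  lift : TightEdgeShape (suc n) (shadow i G) → TightEdgeShape (suc (suc n)) G
  lift (inj₁ (x , shadow≐)) =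
    inj₁ (shadow-N[]∧common-single⇒N[] i G (Fort.rule f) x shadow≐ w w∈common common⊆w)
  lift (inj₂ parallel) =
    contradiction common⊆w (shadow-ParallelEdges-common-not-single n i G (Fort.rule f) parallel w w∈common)

TightEdgeForts-classified-all : ∀ n → TightEdgeForts-classified n
TightEdgeForts-classified-all zero = TightEdgeForts-classified-Q₁
TightEdgeForts-classified-all (suc n) G f e cG with HasEdge⇒common G e
... | i , w , w∈common with ≐-or-differ (slice i G true) (slice i G false)
...   | inj₁ same         = inj₂ (equal-slices-ParallelEdges i G f cG same)
...   | inj₂ (v , differ) = distinct-slices-shape (TightEdgeForts-classified-all n) i G f cG w w∈common v differ

TightForts-classified-all : ∀ n → TightForts-classified n
TightForts-classified-all n = TightForts-classified-step (TightEdgeForts-classified-all n)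

-- Zero forcing

Black-avoids-Fort : {W F : VSet n} → FortRule F → F ⊆ᵛ W → ∀ v → Black (compl W) v → F v ≡ false
Black-avoids-Fort {F = F} rule F⊆W v (initial v∉W) with F v in fv
... | false = refl
... | true  = contradiction (subst (λ b → T (not b)) (F⊆W v fv) v∉W) λ ()
Black-avoids-Fort {F = F} rule F⊆W w (force {u} bu u~w others) with F w in fw
... | false = refl
... | true  = let w′ , u~w′ , w′≢w , fw′ = rule u w (Black-avoids-Fort rule F⊆W u bu) u~w fw
              in  contradiction (trans (sym (Black-avoids-Fort rule F⊆W w′ (others w′ u~w′ w′≢w))) fw′) λ ()

Fort⊆⇒ZeroBlocking : {W F : VSet n} → Fort F → F ⊆ᵛ W → ZeroBlocking W
Fort⊆⇒ZeroBlocking (fort (v , fv) rule) F⊆W all-black =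
  contradiction (trans (sym (Black-avoids-Fort rule F⊆W v (all-black v))) fv) λ ()

-- Black comes with no decision procedure, so the fort of never-forced vertices is only obtained
-- under ¬¬; this suffices because every conclusion drawn from it is decidable.
¬¬-all-Dec : (P : Vertex n → Set) → ¬ ¬ (∀ v → Dec (P v))
¬¬-all-Dec {zero}  P ¬dec = ¬¬-excluded-middle λ p? → ¬dec λ { [] → p? }
¬¬-all-Dec {suc n} P ¬dec =
  ¬¬-all-Dec (λ v → P (true ∷ v)) λ p₁? → ¬¬-all-Dec (λ v → P (false ∷ v)) λ p₀? →
  ¬dec λ { (true ∷ v) → p₁? v ; (false ∷ v) → p₀? v }

module _ {W : VSet n} (black? : ∀ v → Dec (Black (compl W) v)) where

  stalled : VSet n
  stalled v = not ⌊ black? v ⌋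

  stalled⇒¬Black : ∀ v → stalled v ≡ true → ¬ Black (compl W) v
  stalled⇒¬Black v s b with black? v
  ... | yes _  = contradiction s λ ()
  ... | no ¬b  = ¬b b

  ¬stalled⇒Black : ∀ v → stalled v ≡ false → Black (compl W) v
  ¬stalled⇒Black v s with black? v
  ... | yes b = b
  ... | no _  = contradiction s λ ()

  stalled⊆W : stalled ⊆ᵛ W
  stalled⊆W v s with W v in wv
  ... | true  = refl
  ... | false = contradiction (initial (subst (λ b → T (not b)) (sym wv) _)) (stalled⇒¬Black v s)

  stalled-rule : FortRule stalled
  stalled-rule u w su u~w sw
    with anySubset? (λ w′ → (dist u w′ ≟ 1) ×-dec ¬? (w′ ≟ᵛ w) ×-dec (stalled w′ B.≟ true))
  ... | yes other = other
  ... | no ¬other = contradiction (force (¬stalled⇒Black u su) u~w black) (stalled⇒¬Black w sw)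
    where
    black : ∀ v → Adj u v → v ≢ w → Black (compl W) v
    black v u~v v≢w = ¬stalled⇒Black v (¬-not λ sv → ¬other (v , u~v , v≢w , sv))

  stalled-Fort : ZeroBlocking W → Fort stalled
  stalled-Fort blocking with anySubset? (λ v → stalled v B.≟ true)
  ... | yes some = fort some stalled-rule
  ... | no none  = contradiction (λ v → ¬stalled⇒Black v (¬-not λ sv → none (v , sv))) blocking

ZeroBlocking⇒Fort : {W : VSet n} → ZeroBlocking W → ¬ ¬ (∃ λ F → Fort F × F ⊆ᵛ W)
ZeroBlocking⇒Fort {W = W} blocking =
  ¬¬-map (λ black? → stalled black? , stalled-Fort black? blocking , stalled⊆W black?)
         (¬¬-all-Dec (Black (compl W)))

N-Fort : (x : Vertex (suc (suc n))) → Fort (N x)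
N-Fort x = fort (toggle zero x , Adj⇒N x _ (Adj-toggle zero x)) rule
  where
  rule : FortRule (N x)
  rule u w _ u~w w∈N with Adj⇒toggle x w (N⇒Adj x w w∈N)
  ... | a , refl with u ≟ᵛ x
  ...   | yes refl = let c , a≢c = another a in
    toggle c u , Adj-toggle c u , (λ e → a≢c (sym (toggle-injective c a u e))) ,
    Adj⇒N u _ (Adj-toggle c u)
  ...   | no u≢x with Adj⇒toggle (toggle a x) u (Adj-sym u _ u~w)
  ...     | e , refl with e Fin.≟ a
  ...       | yes refl = contradiction (toggle-involutive e x) u≢x
  ...       | no e≢a   =
    toggle e x , u~ex , (λ eq → e≢a (toggle-injective e a x eq)) , Adj⇒N x _ (Adj-toggle e x)
    where
    u~ex : Adj (toggle e (toggle a x)) (toggle e x)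
    u~ex = Adj-sym (toggle e x) _ (subst (Adj (toggle e x)) (toggle-comm a e x) (Adj-toggle a (toggle e x)))

TightShape? : (W : VSet n) → Dec (TightShape n W)
TightShape? {n} W = anySubset? (λ x → W ≐? N x) ⊎-dec
  ((n ≟ 4) ×-dec anySubset? λ y → anySubset? λ z → (∣ y Δ z ∣ ≟ 2) ×-dec (W ≐? (N y ΔV N z)))

TightShape⇒card : (W : VSet n) → TightShape n W → card W ≡ n
TightShape⇒card W (inj₁ (x , W≐)) = trans (card≡count W) (trans (count-cong W _ W≐) (count-N x))
TightShape⇒card W (inj₂ (refl , y , z , d , W≐)) =
  trans (card≡count W) (trans (count-cong W _ W≐) (ΔN-size y z d))

ZeroBlocking-size : (W : VSet n) → ZeroBlocking W → n ≤ card W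
ZeroBlocking-size {n} W blocking =
  decidable-stable (n ≤? card W) (¬¬-map bound (ZeroBlocking⇒Fort blocking))
  where
  bound : ∃ (λ F → Fort F × F ⊆ᵛ W) → n ≤ card W
  bound (F , f , F⊆W) =
    ≤-trans (Fort-size F f) (≤-trans (count-mono F W F⊆W) (≤-reflexive (sym (card≡count W))))

tight-ZeroBlocking-shape : (W : VSet (suc (suc n))) → ZeroBlocking W → card W ≡ suc (suc n) →
                           TightShape (suc (suc n)) W
tight-ZeroBlocking-shape {n} W blocking cW =
  decidable-stable (TightShape? W) (¬¬-map shape (ZeroBlocking⇒Fort blocking))
  where
  cW′ = trans (sym (card≡count W)) cW
  shape : ∃ (λ F → Fort F × F ⊆ᵛ W) → TightShape (suc (suc n)) W
  shape (F , f , F⊆W) = TightForts-classified-all n W (Fort-cong F W (λ v → sym (W≐F v)) f) cW′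
    where W≐F = ⊆∧count≤⇒≐ F W F⊆W (≤-trans (≤-reflexive cW′) (Fort-size F f))

theorem6 : (n : ℕ) → 2 ≤ n →
    -- B(Q_n) = n : some zero blocking set has size n, and all have size ≥ n
    ((Σ (VSet n) λ W → ZeroBlocking W × card W ≡ n)
      × (∀ (W : VSet n) → ZeroBlocking W → n ≤ card W))
    × (∀ (W : VSet n) → ZeroBlocking W →
        (card W ≡ n ⇔
          ((Σ (Vertex n) λ x → W ≐ N x)
           ⊎ (n ≡ 4 × Σ (Vertex n) λ y → Σ (Vertex n) λ z →
                ∣ y Δ z ∣ ≡ 2 × W ≐ (N y ΔV N z)))))
theorem6 (suc (suc n)) (s≤s (s≤s z≤n)) =
  ((N x₀ , N-ZeroBlocking , TightShape⇒card (N x₀) (inj₁ (x₀ , λ _ → refl))) , ZeroBlocking-size) ,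
  λ W blocking → mk⇔ (tight-ZeroBlocking-shape W blocking) (TightShape⇒card W)
  where
  x₀ : Vertex (suc (suc n))
  x₀ = replicate _ false
  N-ZeroBlocking : ZeroBlocking (N x₀)
  N-ZeroBlocking = Fort⊆⇒ZeroBlocking (N-Fort x₀) (λ _ e → e)
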